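{- Let $p$ be an odd prime and let $W$ be a weighing matrix of order $n$ and weight $k$. If $p$ divides $k$ but $p^2$ does not divide $k$, then the $\mathbb{F}_p$-code $C_p(W)$ generated by the rows of $W$ (entries read in $\mathbb{F}_p$) is self-dual.
   Context: A weighing matrix of order $n$ and weight $k$ is an $n\times n$ matrix $W$ with entries in $\{1,-1,0\}$ such that $WW^T=kI_n$. $C_p(W)$ is the $\mathbb{F}_p$-linear subspace of $\mathbb{F}_p^n$ spanned by the rows of $W$ reduced modulo $p$. For a code $C\subseteq\mathbb{F}_p^n$, $C^\perp=\{x: x\cdot y=0\ \forall y\in C\}$ (standard inner product), and $C$ is self-dual if $C=C^\perp$. -}

module Defs where

open import Data.Nat using (ℕ; suc)
open import Data.Nat.Primality using (Prime)
open import Data.Fin using (Fin; toℕ)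
import Data.Fin as Fin
open import Data.Integer using (ℤ; +_; -_; _+_; _-_; _*_; 0ℤ; 1ℤ)
open import Data.Integer.Divisibility using (_∣_)
open import Data.Product using (Σ; _×_)
open import Data.Sum using (_⊎_)
open import Relation.Binary.PropositionalEquality using (_≡_)
open import Relation.Nullary using (¬_)
open import Function.Bundles using (_⇔_)

∑ : (n : ℕ) → (Fin n → ℤ) → ℤ
∑ ℕ.zero f = 0ℤ
∑ (suc n) f = f Fin.zero + ∑ n (λ i → f (Fin.suc i))

Matrix : ℕ → Set
Matrix n = Fin n → Fin n → ℤ

Ternary : ℤ → Set
Ternary x = (x ≡ 1ℤ) ⊎ ((x ≡ - 1ℤ) ⊎ (x ≡ 0ℤ))

δ : {n : ℕ} → Fin n → Fin n → ℤ
δ Fin.zero Fin.zero = 1ℤ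
δ Fin.zero (Fin.suc j) = 0ℤ
δ (Fin.suc i) Fin.zero = 0ℤ
δ (Fin.suc i) (Fin.suc j) = δ i j

IsWeighingMatrix : (n k : ℕ) → Matrix n → Set
IsWeighingMatrix n k W =
  ((i j : Fin n) → Ternary (W i j)) ×
  ((i j : Fin n) → ∑ n (λ l → W i l * W j l) ≡ (+ k) * δ i j)

-- elements of 𝔽_p are represented by their canonical residues Fin p;
-- vectors of 𝔽_p^n are functions Fin n → Fin p.
Vecₚ : ℕ → ℕ → Set
Vecₚ p n = Fin n → Fin p

lift : {p : ℕ} → Fin p → ℤ
lift a = + (toℕ a)

_≡[mod_]_ : ℤ → ℕ → ℤ → Set
a ≡[mod p ] b = (+ p) ∣ (a - b)

Code : ℕ → ℕ → Set₁
Code p n = Vecₚ p n → Set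

rowCode : (p n : ℕ) → Matrix n → Code p n
rowCode p n W x =
  Σ (Vecₚ p n) λ c → (j : Fin n) →
    lift (x j) ≡[mod p ] ∑ n (λ i → lift (c i) * W i j)

Orth : (p n : ℕ) → Vecₚ p n → Vecₚ p n → Set
Orth p n x y = ∑ n (λ j → lift (x j) * lift (y j)) ≡[mod p ] 0ℤ

dual : (p n : ℕ) → Code p n → Code p n
dual p n C x = (y : Vecₚ p n) → C y → Orth p n x y

SelfDual : (p n : ℕ) → Code p n → Set
SelfDual p n C = (x : Vecₚ p n) → C x ⇔ dual p n C x

-- Write k = m p, so that p ∤ m.
--
--  * C ⊆ C^⊥: W Wᵀ = k·I ≡ 0 (mod p), so the rows are pairwise orthogonal
--    mod p, and the inner product of two row combinations is a
--    combination of inner products of rows.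
--  * C^⊥ ⊆ C: W Wᵀ = k·I also forces Wᵀ W = k·I.  This is shown over ℤ,
--    where k need not be invertible: M = Wᵀ W − k·I is symmetric with
--    M² = −k·M and tr M = 0, so the sum of squares tr (M Mᵀ) vanishes.
--    If x ⊥ C then Wᵢ · x = p zᵢ for all i, and p Σᵢ zᵢ Wᵢ = Wᵀ W x = m p x;
--    hence x ≡ m⁻¹ Σᵢ zᵢ Wᵢ (mod p) lies in C.

module Submission where

open import Defs
open import Data.Nat using (ℕ; _^_)
open import Relation.Binary.PropositionalEquality using (_≢_)
open import Data.Nat.Primality using (Prime)
open import Data.Nat.Divisibility using (_∣_)
open import Relation.Nullary using (¬_; contradiction)

import Data.Nat as ℕ
import Data.Nat.Properties as ℕ
import Data.Nat.Divisibility as ND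
open import Data.Nat.Primality using (prime⇒nonZero; prime⇒irreducible)
open import Data.Nat.Coprimality using (Coprime; coprime-Bézout)
open import Data.Nat.GCD using (module Bézout)
open import Data.Fin using (Fin; zero; suc; fromℕ<)
open import Data.Fin.Properties using (toℕ-fromℕ<)
open import Data.Integer using (ℤ; +_; -_; _+_; _-_; _*_; 0ℤ; 1ℤ; -[1+_])
open import Data.Integer.Properties
open import Data.Integer.DivMod using (_%ℕ_; _/ℕ_; n%ℕd<d; a≡a%ℕn+[a/ℕn]*n)
import Data.Integer.Divisibility.Signed as Signed
open import Data.Integer.Tactic.RingSolver using (solve-∀)
open import Data.Product using (Σ; _,_; proj₁; proj₂)
open import Data.Sum using (inj₁; inj₂)
open import Relation.Binary.PropositionalEquality
open import Relation.Binary.Bundles using (Setoid)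
import Relation.Binary.Reasoning.Setoid as SetoidReasoning
open import Function.Bundles using (mk⇔)

∑-cong : ∀ n {f g : Fin n → ℤ} → (∀ i → f i ≡ g i) → ∑ n f ≡ ∑ n g
∑-cong ℕ.zero    f≡g = refl
∑-cong (ℕ.suc n) f≡g = cong₂ _+_ (f≡g zero) (∑-cong n (λ i → f≡g (suc i)))

∑-zero : ∀ n → ∑ n (λ _ → 0ℤ) ≡ 0ℤ
∑-zero ℕ.zero    = refl
∑-zero (ℕ.suc n) = trans (+-identityˡ _) (∑-zero n)

∑-+ : ∀ n (f g : Fin n → ℤ) → ∑ n (λ i → f i + g i) ≡ ∑ n f + ∑ n g
∑-+ ℕ.zero    f g = refl
∑-+ (ℕ.suc n) f g = begin
  (f zero + g zero) + ∑ n (λ i → f (suc i) + g (suc i))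
    ≡⟨ cong (_+_ (f zero + g zero)) (∑-+ n (λ i → f (suc i)) (λ i → g (suc i))) ⟩
  (f zero + g zero) + (∑ n (λ i → f (suc i)) + ∑ n (λ i → g (suc i)))
    ≡⟨ interchange (f zero) (g zero) _ _ ⟩
  (f zero + ∑ n (λ i → f (suc i))) + (g zero + ∑ n (λ i → g (suc i))) ∎
  where
  open ≡-Reasoning
  interchange : ∀ a b c d → (a + b) + (c + d) ≡ (a + c) + (b + d)
  interchange = solve-∀

∑-neg : ∀ n (f : Fin n → ℤ) → ∑ n (λ i → - f i) ≡ - ∑ n f
∑-neg ℕ.zero    f = refl
∑-neg (ℕ.suc n) f =
  trans (cong (_+_ (- f zero)) (∑-neg n (λ i → f (suc i))))
        (sym (neg-distrib-+ (f zero) _))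

∑-- : ∀ n (f g : Fin n → ℤ) → ∑ n (λ i → f i - g i) ≡ ∑ n f - ∑ n g
∑-- n f g = trans (∑-+ n f (λ i → - g i)) (cong (_+_ (∑ n f)) (∑-neg n g))

∑-*ˡ : ∀ n a (f : Fin n → ℤ) → ∑ n (λ i → a * f i) ≡ a * ∑ n f
∑-*ˡ ℕ.zero    a f = sym (*-zeroʳ a)
∑-*ˡ (ℕ.suc n) a f =
  trans (cong (_+_ (a * f zero)) (∑-*ˡ n a (λ i → f (suc i))))
        (sym (*-distribˡ-+ a (f zero) _))

∑-*ʳ : ∀ n a (f : Fin n → ℤ) → ∑ n (λ i → f i * a) ≡ ∑ n f * a
∑-*ʳ n a f = begin
  ∑ n (λ i → f i * a) ≡⟨ ∑-cong n (λ i → *-comm (f i) a) ⟩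
  ∑ n (λ i → a * f i) ≡⟨ ∑-*ˡ n a f ⟩
  a * ∑ n f           ≡⟨ *-comm a (∑ n f) ⟩
  ∑ n f * a           ∎
  where open ≡-Reasoning

∑-swap : ∀ n m (f : Fin n → Fin m → ℤ) →
  ∑ n (λ i → ∑ m (f i)) ≡ ∑ m (λ j → ∑ n (λ i → f i j))
∑-swap ℕ.zero    m f = sym (∑-zero m)
∑-swap (ℕ.suc n) m f =
  trans (cong (_+_ (∑ m (f zero))) (∑-swap n m (λ i → f (suc i))))
        (sym (∑-+ m (f zero) (λ j → ∑ n (λ i → f (suc i) j))))

δ-sym : ∀ {n} (i j : Fin n) → δ i j ≡ δ j i
δ-sym zero    zero    = refl
δ-sym zero    (suc j) = refl
δ-sym (suc i) zero    = refl
δ-sym (suc i) (suc j) = δ-sym i j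

∑-δʳ : ∀ n (f : Fin n → ℤ) j → ∑ n (λ l → f l * δ l j) ≡ f j
∑-δʳ (ℕ.suc n) f zero = begin
  f zero * 1ℤ + ∑ n (λ l → f (suc l) * 0ℤ)
    ≡⟨ cong₂ _+_ (*-identityʳ (f zero))
                 (trans (∑-cong n (λ l → *-zeroʳ (f (suc l)))) (∑-zero n)) ⟩
  f zero + 0ℤ ≡⟨ +-identityʳ (f zero) ⟩
  f zero      ∎
  where open ≡-Reasoning
∑-δʳ (ℕ.suc n) f (suc j) =
  trans (cong₂ _+_ (*-zeroʳ (f zero)) (∑-δʳ n (λ l → f (suc l)) j)) (+-identityˡ _)

∑-δˡ : ∀ n (f : Fin n → ℤ) j → ∑ n (λ l → δ j l * f l) ≡ f j
∑-δˡ n f j =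
  trans (∑-cong n (λ l → trans (*-comm (δ j l) (f l)) (cong (f l *_) (δ-sym j l))))
        (∑-δʳ n f j)

Natural : ℤ → Set
Natural x = Σ ℕ (λ a → x ≡ + a)

∑-natural : ∀ n (f : Fin n → ℤ) → (∀ i → Natural (f i)) → Natural (∑ n f)
∑-natural ℕ.zero    f nat = 0 , refl
∑-natural (ℕ.suc n) f nat with nat zero | ∑-natural n (λ i → f (suc i)) (λ i → nat (suc i))
... | a , fa | s , fs = a ℕ.+ s , cong₂ _+_ fa fs

∑-natural-zero : ∀ n (f : Fin n → ℤ) → (∀ i → Natural (f i)) →
  ∑ n f ≡ 0ℤ → ∀ i → f i ≡ 0ℤ
∑-natural-zero (ℕ.suc n) f nat sum≡0 i
  with nat zero | ∑-natural n (λ i → f (suc i)) (λ i → nat (suc i))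
... | a , fa | s , fs = termwise i
  where
  a+s≡0 : a ℕ.+ s ≡ 0
  a+s≡0 = +-injective (trans (sym (cong₂ _+_ fa fs)) sum≡0)
  termwise : ∀ i → f i ≡ 0ℤ
  termwise zero    = trans fa (cong +_ (ℕ.m+n≡0⇒m≡0 a a+s≡0))
  termwise (suc i) = ∑-natural-zero n (λ i → f (suc i)) (λ i → nat (suc i))
                       (trans fs (cong +_ (ℕ.m+n≡0⇒n≡0 a a+s≡0))) i

square-natural : ∀ x → Natural (x * x)
square-natural (+ a)    = a ℕ.* a , sym (pos-* a a)
square-natural -[1+ a ] = _ , refl

square-zero : ∀ x → x * x ≡ 0ℤ → x ≡ 0ℤ
square-zero x x²≡0 with i*j≡0⇒i≡0∨j≡0 x x²≡0
... | inj₁ x≡0 = x≡0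
... | inj₂ x≡0 = x≡0

infix  4 _≐_
infixl 6 _⊖_
infixl 7 _⊗_ _∙_
infix  9 _ᵀ

_≐_ : ∀ {n} → Matrix n → Matrix n → Set
A ≐ B = ∀ i j → A i j ≡ B i j

_ᵀ : ∀ {n} → Matrix n → Matrix n
(A ᵀ) i j = A j i

_⊗_ : ∀ {n} → Matrix n → Matrix n → Matrix n
_⊗_ {n} A B i j = ∑ n (λ l → A i l * B l j)

_⊖_ : ∀ {n} → Matrix n → Matrix n → Matrix n
(A ⊖ B) i j = A i j - B i j

_∙_ : ∀ {n} → ℤ → Matrix n → Matrix n
(c ∙ A) i j = c * A i j

scalar : ∀ {n} → ℤ → Matrix n
scalar c i j = c * δ i j

𝟘 : ∀ {n} → Matrix n
𝟘 i j = 0ℤ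

trace : ∀ {n} → Matrix n → ℤ
trace {n} A = ∑ n (λ i → A i i)

infix 8 _·_
_·_ : ∀ {n} → (Fin n → ℤ) → (Fin n → ℤ) → ℤ
_·_ {n} u v = ∑ n (λ j → u j * v j)

·-comm : ∀ {n} (u v : Fin n → ℤ) → u · v ≡ v · u
·-comm {n} u v = ∑-cong n (λ j → *-comm (u j) (v j))

combination : ∀ {n} → (Fin n → ℤ) → Matrix n → Fin n → ℤ
combination {n} c B j = ∑ n (λ i → c i * B i j)

-- (cᵀ B) · h = c · (B h); this yields both the associativity of ⊗ and
-- the computation of inner products of codewords.
combination-· : ∀ {n} (c : Fin n → ℤ) (B : Matrix n) (h : Fin n → ℤ) →
  combination c B · h ≡ c · (λ i → B i · h)
combination-· {n} c B h = begin
  ∑ n (λ j → ∑ n (λ i → c i * B i j) * h j)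
    ≡⟨ ∑-cong n (λ j → sym (∑-*ʳ n (h j) (λ i → c i * B i j))) ⟩
  ∑ n (λ j → ∑ n (λ i → c i * B i j * h j))
    ≡⟨ ∑-swap n n (λ j i → c i * B i j * h j) ⟩
  ∑ n (λ i → ∑ n (λ j → c i * B i j * h j))
    ≡⟨ ∑-cong n (λ i → ∑-cong n (λ j → *-assoc (c i) (B i j) (h j))) ⟩
  ∑ n (λ i → ∑ n (λ j → c i * (B i j * h j)))
    ≡⟨ ∑-cong n (λ i → ∑-*ˡ n (c i) (λ j → B i j * h j)) ⟩
  ∑ n (λ i → c i * ∑ n (λ j → B i j * h j)) ∎
  where open ≡-Reasoning

⊗-assoc : ∀ {n} (A B C : Matrix n) → (A ⊗ B) ⊗ C ≐ A ⊗ (B ⊗ C)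
⊗-assoc A B C i j = combination-· (A i) B (λ l → C l j)

⊗-congˡ : ∀ {n} {A A′ : Matrix n} (B : Matrix n) → A ≐ A′ → A ⊗ B ≐ A′ ⊗ B
⊗-congˡ {n} B A≐A′ i j = ∑-cong n (λ l → cong (_* B l j) (A≐A′ i l))

⊗-congʳ : ∀ {n} (A : Matrix n) {B B′ : Matrix n} → B ≐ B′ → A ⊗ B ≐ A ⊗ B′
⊗-congʳ {n} A B≐B′ i j = ∑-cong n (λ l → cong (A i l *_) (B≐B′ l j))

⊗-zeroʳ : ∀ {n} (A : Matrix n) → A ⊗ 𝟘 ≐ 𝟘
⊗-zeroʳ {n} A i j = trans (∑-cong n (λ l → *-zeroʳ (A i l))) (∑-zero n)

∑-scaled-δ : ∀ n (v : Fin n → ℤ) c j → ∑ n (λ l → v l * (c * δ l j)) ≡ c * v j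
∑-scaled-δ n v c j = begin
  ∑ n (λ l → v l * (c * δ l j)) ≡⟨ ∑-cong n (λ l → reassoc (v l) c (δ l j)) ⟩
  ∑ n (λ l → c * v l * δ l j)   ≡⟨ ∑-δʳ n (λ l → c * v l) j ⟩
  c * v j                       ∎
  where
  open ≡-Reasoning
  reassoc : ∀ a c d → a * (c * d) ≡ c * a * d
  reassoc = solve-∀

⊗-scalarʳ : ∀ {n} (A : Matrix n) c → A ⊗ scalar c ≐ c ∙ A
⊗-scalarʳ {n} A c i j = ∑-scaled-δ n (A i) c j

scalar-⊗ : ∀ {n} c (A : Matrix n) → scalar c ⊗ A ≐ c ∙ A
scalar-⊗ {n} c A i j = begin
  ∑ n (λ l → c * δ i l * A l j) ≡⟨ ∑-cong n (λ l → *-assoc c (δ i l) (A l j)) ⟩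
  ∑ n (λ l → c * (δ i l * A l j)) ≡⟨ ∑-*ˡ n c (λ l → δ i l * A l j) ⟩
  c * ∑ n (λ l → δ i l * A l j) ≡⟨ cong (c *_) (∑-δˡ n (λ l → A l j) i) ⟩
  c * A i j ∎
  where open ≡-Reasoning

⊗-distribʳ-⊖ : ∀ {n} (A B C : Matrix n) → (A ⊖ B) ⊗ C ≐ A ⊗ C ⊖ B ⊗ C
⊗-distribʳ-⊖ {n} A B C i j =
  trans (∑-cong n (λ l → *-distribʳ-- (A i l) (B i l) (C l j)))
        (∑-- n (λ l → A i l * C l j) (λ l → B i l * C l j))
  where
  *-distribʳ-- : ∀ a b c → (a - b) * c ≡ a * c - b * c
  *-distribʳ-- = solve-∀

⊗-distribˡ-⊖ : ∀ {n} (A B C : Matrix n) → A ⊗ (B ⊖ C) ≐ A ⊗ B ⊖ A ⊗ C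
⊗-distribˡ-⊖ {n} A B C i j =
  trans (∑-cong n (λ l → *-distribˡ-- (A i l) (B l j) (C l j)))
        (∑-- n (λ l → A i l * B l j) (λ l → A i l * C l j))
  where
  *-distribˡ-- : ∀ a b c → a * (b - c) ≡ a * b - a * c
  *-distribˡ-- = solve-∀

trace-gram : ∀ {n} (A : Matrix n) → trace (A ᵀ ⊗ A) ≡ trace (A ⊗ A ᵀ)
trace-gram {n} A = ∑-swap n n (λ l i → A i l * A i l)

trace-gram-zero : ∀ {n} (A : Matrix n) → trace (A ⊗ A ᵀ) ≡ 0ℤ → A ≐ 𝟘
trace-gram-zero {n} A tr≡0 i j = square-zero (A i j)
  (∑-natural-zero n (λ l → A i l * A i l) (λ l → square-natural (A i l))
    (∑-natural-zero n (λ i → ∑ n (λ l → A i l * A i l)) rowNatural tr≡0 i) j)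
  where
  rowNatural : ∀ i → Natural (∑ n (λ l → A i l * A i l))
  rowNatural i = ∑-natural n _ (λ l → square-natural (A i l))

-- Over a field this is "a right
-- inverse is a left inverse"; here K may be 0 or non-invertible, so we
-- argue in ℤ: M = Wᵀ W − K·I is symmetric with M² = −K·M and tr M = 0,
-- hence tr (M Mᵀ) = −K·tr M = 0 and M vanishes.
columns-orthogonal : ∀ {n} K (W : Matrix n) → W ⊗ W ᵀ ≐ scalar K → W ᵀ ⊗ W ≐ scalar K
columns-orthogonal {n} K W WWᵀ≐K i j = i-j≡0⇒i≡j _ _ (trace-gram-zero M trace-MMᵀ i j)
  where
  open ≡-Reasoning

  G M KI : Matrix n
  G = W ᵀ ⊗ W
  KI = scalar K
  M = G ⊖ KI

  W⊗G : W ⊗ G ≐ K ∙ W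
  W⊗G i j = begin
    (W ⊗ (W ᵀ ⊗ W)) i j ≡⟨ ⊗-assoc W (W ᵀ) W i j ⟨
    (W ⊗ W ᵀ ⊗ W) i j   ≡⟨ ⊗-congˡ W WWᵀ≐K i j ⟩
    (scalar K ⊗ W) i j  ≡⟨ scalar-⊗ K W i j ⟩
    K * W i j           ∎

  W⊗M : W ⊗ M ≐ 𝟘
  W⊗M i j = begin
    (W ⊗ M) i j                      ≡⟨ ⊗-distribˡ-⊖ W G KI i j ⟩
    (W ⊗ G) i j - (W ⊗ KI) i j ≡⟨ cong₂ _-_ (W⊗G i j) (⊗-scalarʳ W K i j) ⟩
    K * W i j - K * W i j            ≡⟨ +-inverseʳ (K * W i j) ⟩
    0ℤ                               ∎

  G⊗M : G ⊗ M ≐ 𝟘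
  G⊗M i j = begin
    (W ᵀ ⊗ W ⊗ M) i j   ≡⟨ ⊗-assoc (W ᵀ) W M i j ⟩
    (W ᵀ ⊗ (W ⊗ M)) i j ≡⟨ ⊗-congʳ (W ᵀ) W⊗M i j ⟩
    (W ᵀ ⊗ 𝟘) i j       ≡⟨ ⊗-zeroʳ (W ᵀ) i j ⟩
    0ℤ                  ∎

  M⊗M : M ⊗ M ≐ 𝟘 ⊖ K ∙ M
  M⊗M i j = trans (⊗-distribʳ-⊖ G KI M i j)
                  (cong₂ _-_ (G⊗M i j) (scalar-⊗ K M i j))

  M-symmetric : M ᵀ ≐ M
  M-symmetric i j = cong₂ (λ g d → g - K * d)
    (∑-cong n (λ l → *-comm (W l j) (W l i))) (δ-sym j i)

  trace-M : trace M ≡ 0ℤ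
  trace-M = begin
    trace M                             ≡⟨ ∑-- n (λ i → G i i) (λ i → K * δ i i) ⟩
    trace G - trace KI          ≡⟨ cong (_- trace KI) trace-G ⟩
    trace KI - trace KI ≡⟨ +-inverseʳ (trace KI) ⟩
    0ℤ                                  ∎
    where
    trace-G : trace G ≡ trace KI
    trace-G = trans (trace-gram W) (∑-cong n (λ i → WWᵀ≐K i i))

  trace-MMᵀ : trace (M ⊗ M ᵀ) ≡ 0ℤ
  trace-MMᵀ = begin
    trace (M ⊗ M ᵀ)                        ≡⟨ ∑-cong n (λ i → ⊗-congʳ M M-symmetric i i) ⟩
    trace (M ⊗ M)                          ≡⟨ ∑-cong n (λ i → M⊗M i i) ⟩
    ∑ n (λ i → 0ℤ - K * M i i)             ≡⟨ ∑-- n (λ _ → 0ℤ) (λ i → K * M i i) ⟩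
    ∑ n (λ _ → 0ℤ) - ∑ n (λ i → K * M i i) ≡⟨ cong₂ _-_ (∑-zero n) (∑-*ˡ n K (λ i → M i i)) ⟩
    0ℤ - K * trace M                       ≡⟨ cong (λ t → 0ℤ - K * t) trace-M ⟩
    0ℤ - K * 0ℤ                            ≡⟨ cong (λ t → 0ℤ - t) (*-zeroʳ K) ⟩
    0ℤ                                     ∎

gram-action : ∀ {n} K (W : Matrix n) → W ᵀ ⊗ W ≐ scalar K →
  ∀ v j → combination (λ i → W i · v) W j ≡ K * v j
gram-action {n} K W WᵀW≐K v j = begin
  combination (λ i → W i · v) W j         ≡⟨ ∑-cong n (λ i → cong (_* W i j) (·-comm (W i) v)) ⟩
  combination v (W ᵀ) · (λ i → W i j)     ≡⟨ combination-· v (W ᵀ) (λ i → W i j) ⟩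
  v · (λ l → (W ᵀ ⊗ W) l j)               ≡⟨ ∑-cong n (λ l → cong (v l *_) (WᵀW≐K l j)) ⟩
  ∑ n (λ l → v l * (K * δ l j))           ≡⟨ ∑-scaled-δ n v K j ⟩
  K * v j                                 ∎
  where open ≡-Reasoning

module Modulo (p : ℕ) .{{_ : ℕ.NonZero p}} where

  infix 4 _≈_

  -- a ≈ b means a ≡ b (mod p), stated with signed divisibility.  It is a
  -- record so that a and b can be recovered from the type by unification.
  record _≈_ (a b : ℤ) : Set where
    constructor mk≈
    field divides : + p Signed.∣ a - b

  ≈-reflexive : ∀ {a b} → a ≡ b → a ≈ b
  ≈-reflexive {a} refl = mk≈ (Signed.divides 0ℤ (+-inverseʳ a))

  ≈-refl : ∀ a → a ≈ a
  ≈-refl a = ≈-reflexive {a} refl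

  ≈-sym : ∀ {a b} → a ≈ b → b ≈ a
  ≈-sym {a} {b} (mk≈ p∣a-b) = mk≈ (subst (+ p Signed.∣_) (negate a b) (Signed.∣m⇒∣-m p∣a-b))
    where
    negate : ∀ a b → - (a - b) ≡ b - a
    negate = solve-∀

  ≈-trans : ∀ {a b c} → a ≈ b → b ≈ c → a ≈ c
  ≈-trans {a} {b} {c} (mk≈ p∣a-b) (mk≈ p∣b-c) =
    mk≈ (subst (+ p Signed.∣_) (telescope a b c) (Signed.∣m∣n⇒∣m+n p∣a-b p∣b-c))
    where
    telescope : ∀ a b c → (a - b) + (b - c) ≡ a - c
    telescope = solve-∀

  ≈-setoid : Setoid _ _
  ≈-setoid = record
    { Carrier = ℤ
    ; _≈_ = _≈_
    ; isEquivalence = record { refl = ≈-refl _ ; sym = ≈-sym ; trans = ≈-trans }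
    }

  module ≈-Reasoning = SetoidReasoning ≈-setoid

  +-cong-≈ : ∀ {a b c d} → a ≈ b → c ≈ d → a + c ≈ b + d
  +-cong-≈ {a} {b} {c} {d} (mk≈ p∣a-b) (mk≈ p∣c-d) =
    mk≈ (subst (+ p Signed.∣_) (regroup a b c d) (Signed.∣m∣n⇒∣m+n p∣a-b p∣c-d))
    where
    regroup : ∀ a b c d → (a - b) + (c - d) ≡ (a + c) - (b + d)
    regroup = solve-∀

  *-cong-≈ : ∀ {a b c d} → a ≈ b → c ≈ d → a * c ≈ b * d
  *-cong-≈ {a} {b} {c} {d} (mk≈ p∣a-b) (mk≈ p∣c-d) =
    mk≈ (subst (+ p Signed.∣_) (regroup a b c d)
          (Signed.∣m∣n⇒∣m+n (Signed.∣m⇒∣m*n c p∣a-b) (Signed.∣n⇒∣m*n b p∣c-d)))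
    where
    regroup : ∀ a b c d → (a - b) * c + b * (c - d) ≡ a * c - b * d
    regroup = solve-∀

  ∑-cong-≈ : ∀ n {f g : Fin n → ℤ} → (∀ i → f i ≈ g i) → ∑ n f ≈ ∑ n g
  ∑-cong-≈ ℕ.zero    f≈g = ≈-refl 0ℤ
  ∑-cong-≈ (ℕ.suc n) f≈g = +-cong-≈ (f≈g zero) (∑-cong-≈ n (λ i → f≈g (suc i)))

  ·-null : ∀ {n} (u v : Fin n → ℤ) → (∀ i → v i ≈ 0ℤ) → u · v ≈ 0ℤ
  ·-null {n} u v v≈0 = ≈-trans
    (∑-cong-≈ n (λ i → *-cong-≈ (≈-refl (u i)) (v≈0 i)))
    (≈-reflexive (trans (∑-cong n (λ i → *-zeroʳ (u i))) (∑-zero n)))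

  multiple-≈0 : ∀ q → q * + p ≈ 0ℤ
  multiple-≈0 q = mk≈ (Signed.divides q (+-identityʳ (q * + p)))

  ≈0⇒multiple : ∀ {a} → a ≈ 0ℤ → Σ ℤ (λ q → a ≡ q * + p)
  ≈0⇒multiple {a} (mk≈ (Signed.divides q a-0≡qp)) = q , trans (sym (+-identityʳ a)) a-0≡qp

  fromMod : ∀ {a b} → a ≡[mod p ] b → a ≈ b
  fromMod p∣a-b = mk≈ (Signed.∣ᵤ⇒∣ p∣a-b)

  toMod : ∀ {a b} → a ≈ b → a ≡[mod p ] b
  toMod (mk≈ p∣a-b) = Signed.∣⇒∣ᵤ p∣a-b

  reduce : ℤ → Fin p
  reduce t = fromℕ< (n%ℕd<d t p)

  lift-reduce : ∀ t → lift (reduce t) ≈ t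
  lift-reduce t = mk≈ (Signed.divides (- (t /ℕ p)) (begin
    lift (reduce t) - t                       ≡⟨ cong (λ r → + r - t) (toℕ-fromℕ< (n%ℕd<d t p)) ⟩
    + (t %ℕ p) - t                            ≡⟨ cong (λ u → + (t %ℕ p) - u) (a≡a%ℕn+[a/ℕn]*n t p) ⟩
    + (t %ℕ p) - (+ (t %ℕ p) + t /ℕ p * + p)  ≡⟨ cancel (+ (t %ℕ p)) (t /ℕ p) (+ p) ⟩
    - (t /ℕ p) * + p                          ∎))
    where
    open ≡-Reasoning
    cancel : ∀ r q P → r - (r + q * P) ≡ - q * P
    cancel = solve-∀

  invertible : ∀ {m} → Prime p → ¬ p ∣ m → Σ ℤ (λ a → a * + m ≈ 1ℤ)
  invertible {m} p-prime p∤m with coprime-Bézout coprime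
    where
    coprime : Coprime m p
    coprime (d∣m , d∣p) with prime⇒irreducible p-prime d∣p
    ... | inj₁ d≡1 = d≡1
    ... | inj₂ d≡p = contradiction (subst (_∣ m) d≡p d∣m) p∤m
  ... | Bézout.+- x y 1+yp≡xm = + x , mk≈ (Signed.divides (+ y) (begin
    + x * + m - 1ℤ   ≡⟨ cong (_- 1ℤ) (pos-* x m) ⟨
    + (x ℕ.* m) - 1ℤ ≡⟨ cong (λ t → + t - 1ℤ) 1+yp≡xm ⟨
    + (1 ℕ.+ y ℕ.* p) - 1ℤ ≡⟨ cong (λ t → t - 1ℤ) (pos-+ 1 (y ℕ.* p)) ⟩
    1ℤ + + (y ℕ.* p) - 1ℤ ≡⟨ cancel (+ (y ℕ.* p)) ⟩
    + (y ℕ.* p)      ≡⟨ pos-* y p ⟩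
    + y * + p        ∎))
    where
    open ≡-Reasoning
    cancel : ∀ t → 1ℤ + t - 1ℤ ≡ t
    cancel = solve-∀
  ... | Bézout.-+ x y 1+xm≡yp = - + x , mk≈ (Signed.divides (- + y) (begin
    - + x * + m - 1ℤ       ≡⟨ rearrange (+ x) (+ m) ⟩
    - (1ℤ + + x * + m)     ≡⟨ cong (λ t → - (1ℤ + t)) (pos-* x m) ⟨
    - (+ (1 ℕ.+ x ℕ.* m))  ≡⟨ cong (λ t → - + t) 1+xm≡yp ⟩
    - + (y ℕ.* p)          ≡⟨ cong -_ (pos-* y p) ⟩
    - (+ y * + p)          ≡⟨ neg-distribˡ-* (+ y) (+ p) ⟩
    - + y * + p            ∎))
    where
    open ≡-Reasoning
    rearrange : ∀ x m → - x * m - 1ℤ ≡ - (1ℤ + x * m)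
    rearrange = solve-∀

module RowCode (p : ℕ) .{{_ : ℕ.NonZero p}} {n : ℕ} (W : Matrix n) where

  open Modulo p

  lift⃗ : Vecₚ p n → Fin n → ℤ
  lift⃗ x j = lift (x j)

  row : Fin n → Vecₚ p n
  row i j = reduce (W i j)

  row∈C : ∀ i → rowCode p n W (row i)
  row∈C i = (λ i′ → reduce (δ i i′)) , λ j → toMod (begin
    lift (reduce (W i j))                          ≈⟨ lift-reduce (W i j) ⟩
    W i j                                          ≡⟨ ∑-δˡ n (λ i′ → W i′ j) i ⟨
    ∑ n (λ i′ → δ i i′ * W i′ j)                   ≈⟨ ∑-cong-≈ n (λ i′ → *-cong-≈ (lift-reduce (δ i i′)) (≈-refl (W i′ j))) ⟨
    ∑ n (λ i′ → lift (reduce (δ i i′)) * W i′ j)   ∎)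
    where open ≈-Reasoning

  spanned : ∀ (x c : Vecₚ p n) → (∀ j → lift (x j) ≡[mod p ] combination (lift⃗ c) W j) →
    ∀ j → lift (x j) ≈ combination (lift⃗ c) W j
  spanned x c x≡cW j = fromMod {lift (x j)} {combination (lift⃗ c) W j} (x≡cW j)

  rowCode⊆dual : (∀ i j → (W ⊗ W ᵀ) i j ≈ 0ℤ) →
    ∀ x → rowCode p n W x → dual p n (rowCode p n W) x
  rowCode⊆dual WWᵀ≈0 x (c , x≡cW) y (d , y≡dW) = toMod (begin
    lift⃗ x · lift⃗ y                                 ≈⟨ ∑-cong-≈ n (λ j → *-cong-≈ (spanned x c x≡cW j) (spanned y d y≡dW j)) ⟩
    combination ĉ W · combination d̂ W                ≡⟨ combination-· ĉ W (combination d̂ W) ⟩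
    ĉ · (λ i → W i · combination d̂ W)                ≈⟨ ·-null ĉ _ row⊥dW ⟩
    0ℤ                                               ∎)
    where
    open ≈-Reasoning
    ĉ d̂ : Fin n → ℤ
    ĉ = lift⃗ c
    d̂ = lift⃗ d
    row⊥dW : ∀ i → W i · combination d̂ W ≈ 0ℤ
    row⊥dW i = begin
      W i · combination d̂ W       ≡⟨ ·-comm (W i) (combination d̂ W) ⟩
      combination d̂ W · W i       ≡⟨ combination-· d̂ W (W i) ⟩
      d̂ · (λ i′ → W i′ · W i)     ≈⟨ ·-null d̂ _ (λ i′ → WWᵀ≈0 i′ i) ⟩
      0ℤ                          ∎

  -- If Wᵀ W = m p·I and m is invertible mod p, then C_p(W)^⊥ ⊆ C_p(W):
  -- for x ⊥ C_p(W) every Wᵢ · x̂ is a multiple zᵢ p, and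
  -- p·Σᵢ zᵢ Wᵢ = Σᵢ (Wᵢ · x̂) Wᵢ = m p·x̂, so x̂ = m⁻¹ Σᵢ zᵢ Wᵢ (mod p).
  dual⊆rowCode : ∀ m → W ᵀ ⊗ W ≐ scalar (+ m * + p) → Σ ℤ (λ a → a * + m ≈ 1ℤ) →
    ∀ x → dual p n (rowCode p n W) x → rowCode p n W x
  dual⊆rowCode m WᵀW≐mp (a , a*m≈1) x x⊥C = c , λ j → toMod (≈-sym (combination≈x̂ j))
    where
    x̂ : Fin n → ℤ
    x̂ = lift⃗ x

    rows⊥x : ∀ i → W i · x̂ ≈ 0ℤ
    rows⊥x i = begin
      W i · x̂               ≡⟨ ·-comm (W i) x̂ ⟩
      x̂ · W i               ≈⟨ ∑-cong-≈ n (λ j → *-cong-≈ (≈-refl (x̂ j)) (lift-reduce (W i j))) ⟨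
      x̂ · lift⃗ (row i)      ≈⟨ fromMod {b = 0ℤ} (x⊥C (row i) (row∈C i)) ⟩
      0ℤ                    ∎
      where open ≈-Reasoning

    z : Fin n → ℤ
    z i = proj₁ (≈0⇒multiple (rows⊥x i))

    Wx≡zp : ∀ i → W i · x̂ ≡ z i * + p
    Wx≡zp i = proj₂ (≈0⇒multiple (rows⊥x i))

    zW≡mx : ∀ j → combination z W j ≡ + m * x̂ j
    zW≡mx j = *-cancelʳ-≡ _ _ (+ p) (begin
      combination z W j * + p                  ≡⟨ ∑-*ʳ n (+ p) (λ i → z i * W i j) ⟨
      ∑ n (λ i → z i * W i j * + p)            ≡⟨ ∑-cong n (λ i → swap (z i) (W i j) (+ p)) ⟩
      ∑ n (λ i → z i * + p * W i j)            ≡⟨ ∑-cong n (λ i → cong (_* W i j) (Wx≡zp i)) ⟨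
      combination (λ i → W i · x̂) W j          ≡⟨ gram-action (+ m * + p) W WᵀW≐mp x̂ j ⟩
      + m * + p * x̂ j                          ≡⟨ swap (+ m) (+ p) (x̂ j) ⟩
      + m * x̂ j * + p                          ∎)
      where
      open ≡-Reasoning
      swap : ∀ a b c → a * b * c ≡ a * c * b
      swap = solve-∀

    c : Vecₚ p n
    c i = reduce (a * z i)

    combination≈x̂ : ∀ j → combination (lift⃗ c) W j ≈ x̂ j
    combination≈x̂ j = begin
      combination (lift⃗ c) W j               ≈⟨ ∑-cong-≈ n (λ i → *-cong-≈ (lift-reduce (a * z i)) (≈-refl (W i j))) ⟩
      combination (λ i → a * z i) W j         ≡⟨ ∑-cong n (λ i → *-assoc a (z i) (W i j)) ⟩
      ∑ n (λ i → a * (z i * W i j))           ≡⟨ ∑-*ˡ n a (λ i → z i * W i j) ⟩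
      a * combination z W j                   ≡⟨ cong (a *_) (zW≡mx j) ⟩
      a * (+ m * x̂ j)                         ≡⟨ *-assoc a (+ m) (x̂ j) ⟨
      a * + m * x̂ j                           ≈⟨ *-cong-≈ a*m≈1 (≈-refl (x̂ j)) ⟩
      1ℤ * x̂ j                                ≡⟨ *-identityˡ (x̂ j) ⟩
      x̂ j                                     ∎
      where open ≈-Reasoning

cofactor-indivisible : ∀ {p k} (p∣k : p ∣ k) → ¬ (p ^ 2 ∣ k) → ¬ (p ∣ ND._∣_.quotient p∣k)
cofactor-indivisible {p} (ND.divides m k≡mp) p²∤k p∣m =
  p²∤k (subst₂ ND._∣_ (cong (p ℕ.*_) (sym (ℕ.*-identityʳ p))) (sym k≡mp) (ND.*-monoˡ-∣ p p∣m))

proposition3p2 : (p n k : ℕ) → Prime p → p ≢ 2 → (W : Matrix n) →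
    IsWeighingMatrix n k W → p ∣ k → ¬ (p ^ 2 ∣ k) →
    SelfDual p n (rowCode p n W)
proposition3p2 p n k p-prime _ W (_ , WWᵀ≐k) p∣k p²∤k x =
  mk⇔ (rowCode⊆dual WWᵀ≈0 x) (dual⊆rowCode m WᵀW≐mp m-invertible x)
  where
  instance
    p≢0 : ℕ.NonZero p
    p≢0 = prime⇒nonZero p-prime
  open Modulo p
  open RowCode p W

  m : ℕ
  m = ND._∣_.quotient p∣k

  k≡mp : + k ≡ + m * + p
  k≡mp = trans (cong +_ (ND._∣_.equality p∣k)) (pos-* m p)

  WWᵀ≈0 : ∀ i j → (W ⊗ W ᵀ) i j ≈ 0ℤ
  WWᵀ≈0 i j = begin
    (W ⊗ W ᵀ) i j      ≡⟨ trans (WWᵀ≐k i j) (cong (_* δ i j) k≡mp) ⟩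
    + m * + p * δ i j  ≈⟨ *-cong-≈ (multiple-≈0 (+ m)) (≈-refl (δ i j)) ⟩
    0ℤ * δ i j         ≡⟨ *-zeroˡ (δ i j) ⟩
    0ℤ                 ∎
    where open ≈-Reasoning

  WᵀW≐mp : W ᵀ ⊗ W ≐ scalar (+ m * + p)
  WᵀW≐mp i j = trans (columns-orthogonal (+ k) W WWᵀ≐k i j) (cong (_* δ i j) k≡mp)

  m-invertible : Σ ℤ (λ a → a * + m ≈ 1ℤ)
  m-invertible = invertible p-prime (cofactor-indivisible p∣k p²∤k)
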